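{- For $n\ge 1$ let $S_n$ be the set of binary sequences of length $n$ containing no maximal run of zeros whose length is congruent to $1$ modulo $3$, and let $c_n=|S_n|$. Then $$c_n=c_{n-1}+2c_{n-3}\quad\text{for } n\ge 4,\qquad c_1=1,\ c_2=2,\ c_3=4.$$
   Context: A run of zeros is a maximal block of consecutive zeros; e.g. $00000\in S_5$ since its only run of zeros has length $5\equiv 2\pmod 3$, while $100\notin$... rather, $1000\in S_4$ and $10\notin S_2$. -}

module Defs where

open import Data.Bool using (Bool; true; false)
open import Data.Nat using (ℕ; zero; suc; _+_; _%_)
open import Data.List using (List; []; _∷_; _++_; map; length; filter)
open import Data.List.Relation.Unary.All using (All)
open import Data.Vec using (Vec; []; _∷_; toList)
open import Relation.Nullary using (¬_)
open import Relation.Binary.PropositionalEquality using (_≡_)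
open import Data.List.Relation.Unary.All using (all?)
open import Relation.Nullary.Decidable using (¬?)
open import Data.Nat using (_≟_)

-- A binary sequence: false = 0, true = 1.

-- zeroRuns acc xs : lengths of maximal runs of zeros of a sequence whose
-- current (already read) trailing run of zeros has length acc, followed by xs.
zeroRunsAux : ℕ → List Bool → List ℕ
zeroRunsAux zero    []           = []
zeroRunsAux (suc k) []           = suc k ∷ []
zeroRunsAux acc     (false ∷ xs) = zeroRunsAux (suc acc) xs
zeroRunsAux zero    (true ∷ xs)  = zeroRunsAux zero xs
zeroRunsAux (suc k) (true ∷ xs)  = suc k ∷ zeroRunsAux zero xs

zeroRuns : List Bool → List ℕ
zeroRuns = zeroRunsAux zero

InS : ∀ {n} → Vec Bool n → Set
InS v = All (λ r → ¬ (r % 3 ≡ 1)) (zeroRuns (toList v))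

allSeqs : (n : ℕ) → List (Vec Bool n)
allSeqs zero    = [] ∷ []
allSeqs (suc n) = map (false ∷_) (allSeqs n) ++ map (true ∷_) (allSeqs n)

c : ℕ → ℕ
c n = length (filter (λ v → all? (λ r → ¬? ((r % 3) ≟ 1)) (zeroRuns (toList v))) (allSeqs n))

module Submission where

open import Defs
open import Data.Nat using (ℕ; _+_; _*_; _∸_; _≥_)
open import Data.Product using (_×_)
open import Relation.Binary.PropositionalEquality using (_≡_)

open import Data.Bool using (Bool; true; false)
open import Data.List using (List; []; _∷_; _++_; map; length; filter)
open import Data.List.Properties using (filter-++; filter-≐; filter-none; length-++)
open import Data.List.Relation.Unary.All using (All; []; _∷_; all?; universal)
open import Data.Nat using (zero; suc; _%_; _≟_; s≤s)
open import Data.Nat.Properties using (+-identityʳ; +-comm)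
open import Data.Product using (_,_; proj₁; proj₂)
open import Data.Vec using (_∷_; toList)
open import Function using (_∘_; id)
open import Relation.Binary.PropositionalEquality using (refl; cong; cong₂; module ≡-Reasoning)
open import Relation.Nullary using (¬_; does)
open import Relation.Nullary.Decidable using (¬?)
open import Relation.Unary using (Pred; Decidable; _≐_)

-- Let g a n count the sequences of length n that are admissible when read after
-- a pending run of a zeros, so c n = g 0 n. A leading zero extends the run to
-- a + 1; a leading one closes it, which is allowed iff a ≢ 1 (mod 3), and
-- restarts with a = 0. Hence g a (n + 1) = g (a + 1) n + [a ≢ 1 (mod 3)] g 0 n,
-- and g is 3-periodic in a. Unfolding three steps from a = 0:
-- g 0 (n + 3) = g 0 (n + 2) + g 1 (n + 2) = g 0 (n + 2) + g 2 (n + 1)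
--             = g 0 (n + 2) + g 3 n + g 0 n = g 0 (n + 2) + 2 g 0 n.

length-filter-map : ∀ {a b p} {A : Set a} {B : Set b} {P : Pred B p}
  (P? : Decidable P) (f : A → B) xs →
  length (filter P? (map f xs)) ≡ length (filter (P? ∘ f) xs)
length-filter-map P? f [] = refl
length-filter-map P? f (x ∷ xs) with does (P? (f x))
... | true  = cong suc (length-filter-map P? f xs)
... | false = length-filter-map P? f xs

count : ∀ {p} {P : Pred (List Bool) p} → ℕ → Decidable P → ℕ
count n P? = length (filter (P? ∘ toList) (allSeqs n))

count-≐ : ∀ {p q} {P : Pred (List Bool) p} {Q : Pred (List Bool) q} n
  (P? : Decidable P) (Q? : Decidable Q) → P ≐ Q → count n P? ≡ count n Q?
count-≐ n P? Q? (P⊆Q , Q⊆P) =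
  cong length (filter-≐ (P? ∘ toList) (Q? ∘ toList) (P⊆Q , Q⊆P) (allSeqs n))

count-none : ∀ {p} {P : Pred (List Bool) p} n (P? : Decidable P) →
  (∀ xs → ¬ P xs) → count n P? ≡ 0
count-none n P? ¬P =
  cong length (filter-none (P? ∘ toList) (universal (¬P ∘ toList) (allSeqs n)))

count-suc : ∀ {p} {P : Pred (List Bool) p} n (P? : Decidable P) →
  count (suc n) P? ≡ count n (P? ∘ (false ∷_)) + count n (P? ∘ (true ∷_))
count-suc n P? = begin
  length (filter P?′ (map (false ∷_) seqs ++ map (true ∷_) seqs))
    ≡⟨ cong length (filter-++ P?′ (map (false ∷_) seqs) _) ⟩
  length (filter P?′ (map (false ∷_) seqs) ++ filter P?′ (map (true ∷_) seqs))
    ≡⟨ length-++ (filter P?′ (map (false ∷_) seqs)) ⟩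
  length (filter P?′ (map (false ∷_) seqs)) + length (filter P?′ (map (true ∷_) seqs))
    ≡⟨ cong₂ _+_ (length-filter-map P?′ (false ∷_) seqs) (length-filter-map P?′ (true ∷_) seqs) ⟩
  count n (P? ∘ (false ∷_)) + count n (P? ∘ (true ∷_))
    ∎
  where
  open ≡-Reasoning
  P?′ = P? ∘ toList
  seqs = allSeqs n

OkRun : Pred ℕ _
OkRun r = ¬ r % 3 ≡ 1

okRun? : Decidable OkRun
okRun? r = ¬? (r % 3 ≟ 1)

RunsOkAfter : ℕ → Pred (List Bool) _
RunsOkAfter a xs = All OkRun (zeroRunsAux a xs)

runsOkAfter? : ∀ a → Decidable (RunsOkAfter a)
runsOkAfter? a xs = all? okRun? (zeroRunsAux a xs)

runsOkAfter-false : ∀ a → RunsOkAfter a ∘ (false ∷_) ≐ RunsOkAfter (suc a)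
runsOkAfter-false zero    = id , id
runsOkAfter-false (suc a) = id , id

runsOkAfter-true : ∀ a → OkRun a → RunsOkAfter a ∘ (true ∷_) ≐ RunsOkAfter 0
runsOkAfter-true zero    _  = id , id
runsOkAfter-true (suc a) ok = (λ { (_ ∷ ps) → ps }) , (ok ∷_)

¬runsOkAfter-true : ∀ a → ¬ OkRun a → ∀ xs → ¬ RunsOkAfter a (true ∷ xs)
¬runsOkAfter-true zero    bad xs _       = bad (λ ())
¬runsOkAfter-true (suc a) bad xs (p ∷ _) = bad p

-- (3 + a) % 3 and a % 3 are definitionally equal, so heads of runs transfer as they are.
runsOkAfter-3+ : ∀ a → RunsOkAfter (3 + a) ≐ RunsOkAfter a
runsOkAfter-3+ a = to a , from a
  where
  to : ∀ a {xs} → RunsOkAfter (3 + a) xs → RunsOkAfter a xs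
  to zero    {[]}         _        = []
  to (suc a) {[]}         (p ∷ []) = p ∷ []
  to a       {false ∷ xs} ps       = proj₂ (runsOkAfter-false a) {xs} (to (suc a) {xs} ps)
  to zero    {true ∷ xs}  (_ ∷ ps) = ps
  to (suc a) {true ∷ xs}  (p ∷ ps) = p ∷ ps

  from : ∀ a {xs} → RunsOkAfter a xs → RunsOkAfter (3 + a) xs
  from zero    {[]}         _        = (λ ()) ∷ []
  from (suc a) {[]}         (p ∷ []) = p ∷ []
  from a       {false ∷ xs} ps       = from (suc a) {xs} (proj₁ (runsOkAfter-false a) {xs} ps)
  from zero    {true ∷ xs}  ps       = (λ ()) ∷ ps
  from (suc a) {true ∷ xs}  (p ∷ ps) = p ∷ ps

-- c n is okAfter 0 n definitionally.
okAfter : ℕ → ℕ → ℕ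
okAfter a n = count n (runsOkAfter? a)

closeRun : ℕ → ℕ → ℕ
closeRun a n = count n (runsOkAfter? a ∘ (true ∷_))

okAfter-suc : ∀ a n → okAfter a (suc n) ≡ okAfter (suc a) n + closeRun a n
okAfter-suc a n = begin
  okAfter a (suc n)
    ≡⟨ count-suc n (runsOkAfter? a) ⟩
  count n (runsOkAfter? a ∘ (false ∷_)) + closeRun a n
    ≡⟨ cong (_+ closeRun a n) (count-≐ n (runsOkAfter? a ∘ (false ∷_)) (runsOkAfter? (suc a)) (runsOkAfter-false a)) ⟩
  okAfter (suc a) n + closeRun a n
    ∎
  where open ≡-Reasoning

okAfter-3+ : ∀ a n → okAfter (3 + a) n ≡ okAfter a n
okAfter-3+ a n = count-≐ n (runsOkAfter? (3 + a)) (runsOkAfter? a) (runsOkAfter-3+ a)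

closeRun-ok : ∀ a n → OkRun a → closeRun a n ≡ okAfter 0 n
closeRun-ok a n ok = count-≐ n (runsOkAfter? a ∘ (true ∷_)) (runsOkAfter? 0) (runsOkAfter-true a ok)

closeRun-bad : ∀ a n → ¬ OkRun a → closeRun a n ≡ 0
closeRun-bad a n bad = count-none n (runsOkAfter? a ∘ (true ∷_)) (¬runsOkAfter-true a bad)

okAfter-1 : ∀ n → okAfter 1 (2 + n) ≡ 2 * okAfter 0 n
okAfter-1 n = begin
  okAfter 1 (2 + n)
    ≡⟨ okAfter-suc 1 (1 + n) ⟩
  okAfter 2 (1 + n) + closeRun 1 (1 + n)
    ≡⟨ cong (okAfter 2 (1 + n) +_) (closeRun-bad 1 (1 + n) λ ok → ok refl) ⟩
  okAfter 2 (1 + n) + 0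
    ≡⟨ +-identityʳ _ ⟩
  okAfter 2 (1 + n)
    ≡⟨ okAfter-suc 2 n ⟩
  okAfter 3 n + closeRun 2 n
    ≡⟨ cong₂ _+_ (okAfter-3+ 0 n) (closeRun-ok 2 n λ ()) ⟩
  okAfter 0 n + okAfter 0 n
    ≡⟨ cong (okAfter 0 n +_) (+-identityʳ _) ⟨
  2 * okAfter 0 n
    ∎
  where open ≡-Reasoning

c-3+ : ∀ n → c (3 + n) ≡ c (2 + n) + 2 * c n
c-3+ n = begin
  okAfter 0 (3 + n)
    ≡⟨ okAfter-suc 0 (2 + n) ⟩
  okAfter 1 (2 + n) + closeRun 0 (2 + n)
    ≡⟨ cong₂ _+_ (okAfter-1 n) (closeRun-ok 0 (2 + n) λ ()) ⟩
  2 * okAfter 0 n + okAfter 0 (2 + n)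
    ≡⟨ +-comm (2 * okAfter 0 n) _ ⟩
  okAfter 0 (2 + n) + 2 * okAfter 0 n
    ∎
  where open ≡-Reasoning

theorem4 : ((n : ℕ) → n ≥ 4 → c n ≡ c (n ∸ 1) + 2 * c (n ∸ 3))
    × (c 1 ≡ 1 × c 2 ≡ 2 × c 3 ≡ 4)
theorem4 = recurrence , refl , refl , refl
  where
  recurrence : (n : ℕ) → n ≥ 4 → c n ≡ c (n ∸ 1) + 2 * c (n ∸ 3)
  recurrence (suc (suc (suc (suc n)))) (s≤s (s≤s (s≤s (s≤s _)))) = c-3+ (suc n)
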